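{- Let $\mathcal M=(U,\mathcal L)$ be an oriented matroid of rank $d$ and let $G=G(\mathcal M)$ be its tope graph. A sample $S\in\mathrm{Samp}(\mathcal M)$ is full if and only if the convex subgraph $[S]$ is full.
   Context: Sign vectors, $\circ$, $\mathrm{Sep}$, and $\le$ (product order with $0\le-1,+1$) as usual; $S^0=\{e:S_e=0\}$. An oriented matroid (OM) is $\mathcal M=(U,\mathcal L)$, $\mathcal L\subseteq\{ -1,0,+1\}^U$, containing $\mathbf 0$, closed under composition and negation, satisfying strong elimination (for $X,Y\in\mathcal L$, $e\in\mathrm{Sep}(X,Y)$ some $Z\in\mathcal L$ has $Z_e=0$ and $Z_f=(X\circ Y)_f$ for $f\notin\mathrm{Sep}(X,Y)$), and simple. Its rank is the length of a maximal chain of $(\mathcal L\cup\{\hat1\},\le)$ minus one. Topes are maximal elements of $(\mathcal L,\le)$; $G(\mathcal M)$ has topes as vertices, adjacent iff differing in one coordinate. Deletion: $\mathcal M\setminus A=(U\setminus A,\{X|_{U\setminus A}:X\in\mathcal L\})$. VC-dimension: maximum size of $D\subseteq U$ such that every $Z\in\{\pm1\}^D$ is the restriction of some tope. $\mathrm{Samp}(\mathcal M)=\{S\in\{ -1,0,+1\}^U: S\le T \text{ for some tope } T\}$, and for $S\in\mathrm{Samp}(\mathcal M)$, $[S]$ is the subgraph of $G$ induced by the topes $T$ with $S\le T$ (a nonempty convex subgraph). A sample $S$ is full if $\mathcal M\setminus S^0$ has the same VC-dimension as $\mathcal M$. For $e\in U$ let $G_e^{+}$, $G_e^{ - }$ be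 the subgraphs of $G$ induced by topes with $e$-coordinate $+1$, resp. $-1$, and $E_e$ the edges whose endpoints differ in coordinate $e$. For a convex subgraph $H$, $e\in\mathrm{osc}(H)$ if $H$ contains no edge of $E_e$ but some edge of $E_e$ has exactly one endpoint in $H$ (then $H\subseteq G_e^+$ or $H\subseteq G_e^-$). Define $S_\bot(H)\in\{ -1,0,+1\}^U$ by $S_\bot(H)_e=\pm1$ if $e\in\mathrm{osc}(H)$ and $H\subseteq G_e^{\pm}$, and $0$ otherwise. $H$ is full if the sample $S_\bot(H)$ is full. -}

module Defs where

open import Data.Nat using (ℕ; _≤_)
open import Data.Fin using (Fin)
open import Data.Fin.Subset using (Subset; ∣_∣) renaming (_∈_ to _∈ˢ_)
open import Data.Vec using (Vec; lookup; map; tabulate; replicate)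
open import Data.Bool using (Bool; true; false; if_then_else_)
open import Data.List using (List)
import Data.List as List
import Data.List.Membership.Propositional as LMem
open import Data.Product using (Σ; ∃; _×_; _,_)
open import Data.Sum using (_⊎_)
open import Relation.Nullary using (¬_)
open import Relation.Binary.PropositionalEquality using (_≡_; _≢_)

data Sign : Set where
  neg zer pos : Sign

-neg : Sign → Sign
-neg neg = pos
-neg zer = zer
-neg pos = neg

SignVec : ℕ → Set
SignVec n = Vec Sign n

data _≤ˢ_ : Sign → Sign → Set where
  0≤ : ∀ {s} → zer ≤ˢ s
  refl≤ : ∀ {s} → s ≤ˢ s

_≤ᵛ_ : ∀ {n} → SignVec n → SignVec n → Set
X ≤ᵛ Y = ∀ e → lookup X e ≤ˢ lookup Y e

compSign : Sign → Sign → Sign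
compSign zer t = t
compSign s   t = s

_∘ᵛ_ : ∀ {n} → SignVec n → SignVec n → SignVec n
X ∘ᵛ Y = tabulate (λ e → compSign (lookup X e) (lookup Y e))

negᵛ : ∀ {n} → SignVec n → SignVec n
negᵛ X = map -neg X

zeroᵛ : ∀ {n} → SignVec n
zeroᵛ = replicate _ zer

Sep : ∀ {n} → SignVec n → SignVec n → Fin n → Set
Sep X Y e = (lookup X e ≢ zer) × (lookup X e ≡ -neg (lookup Y e))

module _ {n : ℕ} (L : List (SignVec n)) where
  open LMem using (_∈_)

  record IsOM : Set where
    field
      zero∈    : zeroᵛ ∈ L
      comp∈    : ∀ {X Y} → X ∈ L → Y ∈ L → (X ∘ᵛ Y) ∈ L
      neg∈     : ∀ {X} → X ∈ L → negᵛ X ∈ L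
      strongElim : ∀ {X Y} → X ∈ L → Y ∈ L → ∀ e → Sep X Y e →
                   Σ (SignVec n) λ Z → Z ∈ L × lookup Z e ≡ zer ×
                     (∀ f → ¬ Sep X Y f → lookup Z f ≡ lookup (X ∘ᵛ Y) f)
      -- simple: no loops and no parallel / antiparallel pairs
      noLoop    : ∀ e → Σ (SignVec n) λ X → X ∈ L × lookup X e ≢ zer
      noPar     : ∀ e f → e ≢ f →
                  Σ (SignVec n) λ X → X ∈ L × lookup X e ≢ lookup X f
      noAntiPar : ∀ e f → e ≢ f →
                  Σ (SignVec n) λ X → X ∈ L × lookup X e ≢ -neg (lookup X f)

  IsTope : SignVec n → Set
  IsTope T = T ∈ L × (∀ Y → Y ∈ L → T ≤ᵛ Y → Y ≡ T)

  Shatters : Subset n → Set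
  Shatters D = ∀ (Z : SignVec n) → (∀ e → e ∈ˢ D → lookup Z e ≢ zer) →
               Σ (SignVec n) λ T → IsTope T × (∀ e → e ∈ˢ D → lookup T e ≡ lookup Z e)

  IsVCdim : ℕ → Set
  IsVCdim d = (Σ (Subset n) λ D → ∣ D ∣ ≡ d × Shatters D)
            × (∀ D → Shatters D → ∣ D ∣ ≤ d)

  IsSample : SignVec n → Set
  IsSample S = Σ (SignVec n) λ T → IsTope T × S ≤ᵛ T

  EdgeE : Fin n → SignVec n → SignVec n → Set
  EdgeE e T T' = IsTope T × IsTope T' × lookup T e ≢ lookup T' e ×
                 (∀ f → f ≢ e → lookup T f ≡ lookup T' f)

  -- induced subgraphs are given by their vertex sets (predicates on topes)
  -- e ∈ osc(H)
  Osc : (SignVec n → Set) → Fin n → Set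
  Osc H e = (¬ (Σ (SignVec n) λ T → Σ (SignVec n) λ T' → H T × H T' × EdgeE e T T'))
          × (Σ (SignVec n) λ T → Σ (SignVec n) λ T' → EdgeE e T T' × H T × ¬ H T')

  InHalf : (SignVec n → Set) → Fin n → Sign → Set
  InHalf H e s = ∀ T → H T → lookup T e ≡ s

  -- S is S_⊥(H) (characterised coordinatewise; 0 exactly when neither holds)
  IsSbot : (SignVec n → Set) → SignVec n → Set
  IsSbot H S = ∀ e →
      ((lookup S e ≡ pos → Osc H e × InHalf H e pos) × (Osc H e × InHalf H e pos → lookup S e ≡ pos))
    × ((lookup S e ≡ neg → Osc H e × InHalf H e neg) × (Osc H e × InHalf H e neg → lookup S e ≡ neg))

  Interval : SignVec n → SignVec n → Set
  Interval S T = IsTope T × S ≤ᵛ T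

-- deletion M \ A, encoded on the same ground set by setting the
-- coordinates in A to 0 (isomorphic to the restriction to U \ A)
zeroOut : ∀ {n} → Subset n → SignVec n → SignVec n
zeroOut A X = tabulate (λ e → if lookup A e then zer else lookup X e)

delete : ∀ {n} → List (SignVec n) → Subset n → List (SignVec n)
delete L A = List.map (zeroOut A) L

isZero : Sign → Bool
isZero zer = true
isZero _   = false

zeroSet : ∀ {n} → SignVec n → Subset n
zeroSet S = map isZero S

FullSample : ∀ {n} → List (SignVec n) → SignVec n → Set
FullSample L S = ∀ d₁ d₂ → IsVCdim L d₁ → IsVCdim (delete L (zeroSet S)) d₂ → d₁ ≡ d₂

FullGraph : ∀ {n} → List (SignVec n) → (SignVec n → Set) → Set
FullGraph L H = ∀ S → IsSbot L H S → FullSample L S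

-- Both fullness conditions reduce to one matroidal criterion: deleting A keeps the VC-dimension iff no
-- nonzero covector has its support inside A.  Shattered sets are exactly the independent sets, so deletion
-- never raises the VC-dimension; basis exchange moves a maximum independent set off A unless such a
-- covector exists, and if one does, adding a coordinate of its support to a set shattered by M \ A gives
-- a larger set shattered by M.
--
-- It remains to compare S with S′ = S_⊥([S]).  Every oscillating coordinate e of [S] has S_e ≠ 0, so
-- S⁰ ⊆ S′⁰.  Conversely, [S] is cut out by its oscillating coordinates: a geodesic of the tope graph
-- from T ∈ [S] to a tope agreeing with T on osc([S]) cannot leave [S], as leaving crosses an oscillating
-- coordinate.  So if a covector X vanishes on osc([S]), both X ∘ T and (- X) ∘ T lie in [S], which forces
-- X to vanish on the support of S.  Hence S⁰ and S′⁰ contain the same covector supports.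

module Submission where

open import Defs
open import Data.Bool using (true; false; if_then_else_)
open import Data.Fin using (Fin; zero; suc) renaming (_≟_ to _≟ᶠ_)
open import Data.Fin.Properties using (any?; all?; ¬∀⟶∃¬)
open import Data.Fin.Subset using (Subset; ∣_∣; ⊥; ⁅_⁆; _∪_; _∩_; _-_; _⊆_; _⊂_)
  renaming (_∈_ to _∈ˢ_; _∉_ to _∉ˢ_)
open import Data.Fin.Subset.Properties
  using (_∈?_; ∉⊥; ∣⊥∣≡0; ∣p∣≤n; p⊂q⇒∣p∣<∣q∣; x∈⁅x⁆; x∈⁅y⁆⇒x≡y;
         x∈p∪q⁺; x∈p∪q⁻; p⊆p∪q; x∈p∩q⁺; x∈p∩q⁻; p─q⊆p; p─⊥≡p)
open import Data.List using (List; []; _∷_; allFin)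
open import Data.List.Membership.Propositional using (_∈_)
open import Data.List.Membership.Propositional.Properties using (∈-map⁺; ∈-map⁻; ∈-allFin)
open import Data.List.Relation.Unary.Any using (here; there)
import Data.List.Membership.DecPropositional as DecMembership
open import Data.Nat using (ℕ; zero; suc; _≤_; _<_)
open import Data.Nat.Properties
  using (≤-refl; ≤-trans; ≤-antisym; <-irrefl; ≤∧≢⇒<; n≤0⇒n≡0; ≤-pred; <-≤-trans)
open import Data.Product using (Σ; ∃; _×_; _,_; proj₁; proj₂; uncurry)
open import Data.Sum using (_⊎_; inj₁; inj₂; [_,_]′)
open import Data.Vec using (Vec; []; _∷_; here; there; lookup; tabulate; updateAt; replicate)
open import Data.Vec.Properties
  using (lookup∘tabulate; lookup-map; tabulate∘lookup; tabulate-cong; []=⇒lookup; lookup⇒[]=;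
         lookup-replicate; lookup∘updateAt; lookup∘updateAt′)
open import Function using (_∘_; _∘₂_; id; flip; const)
open import Function.Bundles using (_⇔_; mk⇔; Equivalence)
open import Relation.Binary.PropositionalEquality using (_≡_; _≢_; refl; sym; trans; cong; subst)
open import Relation.Nullary using (¬_; Dec; does; yes; no; contradiction; _⊎-dec_)
open import Relation.Nullary.Decidable
  using (decidable-stable; ¬¬-excluded-middle; ¬?; _×-dec_; dec-true; dec-false)

_≟ˢ_ : (s t : Sign) → Dec (s ≡ t)
neg ≟ˢ neg = yes refl
zer ≟ˢ zer = yes refl
pos ≟ˢ pos = yes refl
neg ≟ˢ zer = no λ ()
neg ≟ˢ pos = no λ ()
zer ≟ˢ neg = no λ ()
zer ≟ˢ pos = no λ ()
pos ≟ˢ neg = no λ ()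
pos ≟ˢ zer = no λ ()

_≤ˢ?_ : (s t : Sign) → Dec (s ≤ˢ t)
zer ≤ˢ? t   = yes 0≤
neg ≤ˢ? neg = yes refl≤
pos ≤ˢ? pos = yes refl≤
neg ≤ˢ? zer = no λ ()
neg ≤ˢ? pos = no λ ()
pos ≤ˢ? zer = no λ ()
pos ≤ˢ? neg = no λ ()

≤ˢ⇒≡ : ∀ {s t} → s ≤ˢ t → s ≢ zer → s ≡ t
≤ˢ⇒≡ 0≤    s≢0 = contradiction refl s≢0
≤ˢ⇒≡ refl≤ _   = refl

compSign-≢zer : ∀ {s} t → s ≢ zer → compSign s t ≡ s
compSign-≢zer {neg} t _   = refl
compSign-≢zer {zer} t s≢0 = contradiction refl s≢0
compSign-≢zer {pos} t _   = refl

compSign-≢zerʳ : ∀ s {t} → t ≢ zer → compSign s t ≢ zer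
compSign-≢zerʳ neg _   ()
compSign-≢zerʳ zer t≢0 = t≢0
compSign-≢zerʳ pos _   ()

compSign-zerʳ : ∀ s → compSign s zer ≡ s
compSign-zerʳ neg = refl
compSign-zerʳ zer = refl
compSign-zerʳ pos = refl

compSign-idem : ∀ s → compSign s s ≡ s
compSign-idem neg = refl
compSign-idem zer = refl
compSign-idem pos = refl

s≤ˢcompSign : ∀ s t → s ≤ˢ compSign s t
s≤ˢcompSign neg t = refl≤
s≤ˢcompSign zer t = 0≤
s≤ˢcompSign pos t = refl≤

-neg-involutive : ∀ s → -neg (-neg s) ≡ s
-neg-involutive neg = refl
-neg-involutive zer = refl
-neg-involutive pos = refl

-neg-≢zer : ∀ {s} → s ≢ zer → -neg s ≢ zer
-neg-≢zer {neg} _ ()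
-neg-≢zer {zer} s≢0 = s≢0
-neg-≢zer {pos} _ ()

s≢-neg-s : ∀ {s} → s ≢ zer → s ≢ -neg s
s≢-neg-s {neg} _ ()
s≢-neg-s {zer} s≢0 = λ _ → s≢0 refl
s≢-neg-s {pos} _ ()

≢⇒≡-neg : ∀ {s t} → s ≢ zer → t ≢ zer → s ≢ t → s ≡ -neg t
≢⇒≡-neg {neg} {neg} _ _ s≢t = contradiction refl s≢t
≢⇒≡-neg {neg} {pos} _ _ _   = refl
≢⇒≡-neg {pos} {neg} _ _ _   = refl
≢⇒≡-neg {pos} {pos} _ _ s≢t = contradiction refl s≢t
≢⇒≡-neg {zer}       s≢0 _ _ = contradiction refl s≢0
≢⇒≡-neg {neg} {zer} _ t≢0 _ = contradiction refl t≢0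
≢⇒≡-neg {pos} {zer} _ t≢0 _ = contradiction refl t≢0

-neg-injective : ∀ {s t} → -neg s ≡ -neg t → s ≡ t
-neg-injective {s} {t} -s≡-t = trans (sym (-neg-involutive s)) (trans (cong -neg -s≡-t) (-neg-involutive t))

≢-neg⇒≡ : ∀ {s t} → s ≢ zer → t ≢ zer → s ≢ -neg t → s ≡ t
≢-neg⇒≡ {s} {t} s≢0 t≢0 s≢-t with s ≟ˢ t
... | yes s≡t = s≡t
... | no  s≢t = contradiction (≢⇒≡-neg s≢0 t≢0 s≢t) s≢-t

both-≢⇒≡ : ∀ {s t u} → s ≢ zer → t ≢ zer → u ≢ zer → t ≢ s → u ≢ s → t ≡ u
both-≢⇒≡ s≢0 t≢0 u≢0 t≢s u≢s = trans (≢⇒≡-neg t≢0 s≢0 t≢s) (sym (≢⇒≡-neg u≢0 s≢0 u≢s))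

≢⇒≢⊎≢ : ∀ {a b} (c : Sign) → a ≢ b → c ≢ a ⊎ c ≢ b
≢⇒≢⊎≢ {a} c a≢b with c ≟ˢ a
... | yes refl = inj₂ a≢b
... | no  c≢a  = inj₁ c≢a

∉⇒lookup≡false : ∀ {n} {A : Subset n} {e} → e ∉ˢ A → lookup A e ≡ false
∉⇒lookup≡false {A = A} {e} e∉A with lookup A e in eq
... | false = refl
... | true  = contradiction (lookup⇒[]= e A eq) e∉A

x∉p-x : ∀ {n} (p : Subset n) x → x ∉ˢ p - x
x∉p-x (_ ∷ p) zero    ()
x∉p-x (_ ∷ p) (suc x) (there x∈) = x∉p-x p x x∈

x∈p-y⇒x≢y : ∀ {n} {p : Subset n} {x y} → x ∈ˢ p - y → x ≢ y
x∈p-y⇒x≢y {p = p} x∈ refl = x∉p-x p _ x∈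

∣p∣≡1+∣p-x∣ : ∀ {n} {p : Subset n} {x} → x ∈ˢ p → ∣ p ∣ ≡ suc ∣ p - x ∣
∣p∣≡1+∣p-x∣ {p = true  ∷ p} here       = cong (suc ∘ ∣_∣) (sym (p─⊥≡p p))
∣p∣≡1+∣p-x∣ {p = true  ∷ p} (there x∈) = cong suc (∣p∣≡1+∣p-x∣ x∈)
∣p∣≡1+∣p-x∣ {p = false ∷ p} (there x∈) = ∣p∣≡1+∣p-x∣ x∈

∈-swap⁻ : ∀ {n} {p : Subset n} {x y z} → z ∈ˢ (p - x) ∪ ⁅ y ⁆ → z ≡ y ⊎ (z ∈ˢ p × z ≢ x)
∈-swap⁻ {p = p} {x} {y} z∈ with x∈p∪q⁻ (p - x) ⁅ y ⁆ z∈
... | inj₁ z∈p-x = inj₂ (p─q⊆p p ⁅ x ⁆ z∈p-x , x∈p-y⇒x≢y z∈p-x)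
... | inj₂ z∈⁅y⁆ = inj₁ (x∈⁅y⁆⇒x≡y y z∈⁅y⁆)

≡-lookup : ∀ {n} {A : Set} {u v : Vec A n} → (∀ i → lookup u i ≡ lookup v i) → u ≡ v
≡-lookup {u = u} {v} u≗v =
  trans (sym (tabulate∘lookup u)) (trans (tabulate-cong u≗v) (tabulate∘lookup v))

lookup-∘ᵛ : ∀ {n} (X Y : SignVec n) e → lookup (X ∘ᵛ Y) e ≡ compSign (lookup X e) (lookup Y e)
lookup-∘ᵛ X Y = lookup∘tabulate _

lookup-negᵛ : ∀ {n} (X : SignVec n) e → lookup (negᵛ X) e ≡ -neg (lookup X e)
lookup-negᵛ X e = lookup-map e -neg X

lookup-∘ᵛ-≢zer : ∀ {n} (X Y : SignVec n) {e} → lookup X e ≢ zer → lookup (X ∘ᵛ Y) e ≡ lookup X e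
lookup-∘ᵛ-≢zer X Y {e} Xe≢0 = trans (lookup-∘ᵛ X Y e) (compSign-≢zer _ Xe≢0)

lookup-∘ᵛ-zer : ∀ {n} (X Y : SignVec n) {e} → lookup X e ≡ zer → lookup (X ∘ᵛ Y) e ≡ lookup Y e
lookup-∘ᵛ-zer X Y {e} Xe≡0 = trans (lookup-∘ᵛ X Y e) (cong (λ s → compSign s (lookup Y e)) Xe≡0)

lookup-∘ᵛ-≡ : ∀ {n} (X Y : SignVec n) {e} → lookup X e ≡ lookup Y e → lookup (X ∘ᵛ Y) e ≡ lookup X e
lookup-∘ᵛ-≡ X Y {e} Xe≡Ye =
  trans (lookup-∘ᵛ X Y e) (trans (cong (compSign (lookup X e)) (sym Xe≡Ye)) (compSign-idem _))

≡⇒¬Sep : ∀ {n} (X Y : SignVec n) {e} → lookup X e ≡ lookup Y e → ¬ Sep X Y e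
≡⇒¬Sep X Y Xe≡Ye (Xe≢0 , Xe≡-Ye) = s≢-neg-s Xe≢0 (trans Xe≡-Ye (cong -neg (sym Xe≡Ye)))

zer⇒¬Sep : ∀ {n} (X Y : SignVec n) {e} → lookup Y e ≡ zer → ¬ Sep X Y e
zer⇒¬Sep X Y Ye≡0 (Xe≢0 , Xe≡-Ye) = Xe≢0 (trans Xe≡-Ye (cong -neg Ye≡0))

lookup-zeroOut-∈ : ∀ {n} (A : Subset n) (X : SignVec n) {e} → e ∈ˢ A → lookup (zeroOut A X) e ≡ zer
lookup-zeroOut-∈ A X {e} e∈A rewrite lookup∘tabulate (λ e → if lookup A e then zer else lookup X e) e
                                    | []=⇒lookup e∈A = refl

lookup-zeroOut-∉ : ∀ {n} (A : Subset n) (X : SignVec n) {e} → e ∉ˢ A → lookup (zeroOut A X) e ≡ lookup X e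
lookup-zeroOut-∉ A X {e} e∉A rewrite lookup∘tabulate (λ e → if lookup A e then zer else lookup X e) e
                                    | ∉⇒lookup≡false e∉A = refl

∈-zeroSet⁺ : ∀ {n} (S : SignVec n) {e} → lookup S e ≡ zer → e ∈ˢ zeroSet S
∈-zeroSet⁺ S {e} Se≡0 = lookup⇒[]= e (zeroSet S) (trans (lookup-map e isZero S) (cong isZero Se≡0))

∈-zeroSet⁻ : ∀ {n} (S : SignVec n) {e} → e ∈ˢ zeroSet S → lookup S e ≡ zer
∈-zeroSet⁻ S {e} e∈ with lookup S e | trans (sym (lookup-map e isZero S)) ([]=⇒lookup e∈)
... | zer | _ = refl

FullSupport : ∀ {n} → SignVec n → Set
FullSupport X = ∀ e → lookup X e ≢ zer

replicate-pos-full : ∀ {n} → FullSupport (replicate n pos)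
replicate-pos-full e = subst (_≢ zer) (sym (lookup-replicate e pos)) λ ()

disagree : ∀ {n} → SignVec n → SignVec n → Subset n
disagree X Y = tabulate λ e → does (¬? (lookup X e ≟ˢ lookup Y e))

∈-disagree⁺ : ∀ {n} {X Y : SignVec n} {e} → lookup X e ≢ lookup Y e → e ∈ˢ disagree X Y
∈-disagree⁺ {X = X} {Y} {e} Xe≢Ye =
  lookup⇒[]= e _ (trans (lookup∘tabulate _ e) (dec-true (¬? (lookup X e ≟ˢ lookup Y e)) Xe≢Ye))

∈-disagree⁻ : ∀ {n} {X Y : SignVec n} {e} → e ∈ˢ disagree X Y → lookup X e ≢ lookup Y e
∈-disagree⁻ {X = X} {Y} {e} e∈ Xe≡Ye
  with trans (sym (dec-false (¬? (lookup X e ≟ˢ lookup Y e)) (λ ne → ne Xe≡Ye)))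
             (trans (sym (lookup∘tabulate _ e)) ([]=⇒lookup e∈))
... | ()

record Between {n} (T W V : SignVec n) : Set where
  constructor between
  field agrees : ∀ f → lookup T f ≡ lookup W f → lookup V f ≡ lookup T f

between⇒⊆ : ∀ {n} {T W V : SignVec n} → Between T W V → disagree T V ⊆ disagree T W
between⇒⊆ {T = T} {W} {V} (between V≡T) e∈ =
  ∈-disagree⁺ {X = T} {W} λ Te≡We → ∈-disagree⁻ {X = T} {V} e∈ (sym (V≡T _ Te≡We))

between⇒⊂ : ∀ {n} {T W V : SignVec n} {p} → Between T W V →
            lookup T p ≢ lookup W p → lookup V p ≡ lookup T p → disagree T V ⊂ disagree T W
between⇒⊂ {T = T} {W} {V} {p} V-between Tp≢Wp Vp≡Tp =
  between⇒⊆ V-between , p , ∈-disagree⁺ {X = T} {W} Tp≢Wp ,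
  λ p∈ → ∈-disagree⁻ {X = T} {V} p∈ (sym Vp≡Tp)

-- The VC-dimension and S_⊥ exist only by excluded middle; they are used towards negative goals only.

¬¬-greatest : ∀ {Q : ℕ → Set} b → (∀ k → Q k → k ≤ b) → ∃ Q →
              ¬ ¬ (Σ ℕ λ d → Q d × (∀ k → Q k → k ≤ d))
¬¬-greatest {Q} zero    bounded (k , qk) ¬greatest =
  ¬greatest (0 , subst Q (n≤0⇒n≡0 (bounded k qk)) qk , bounded)
¬¬-greatest {Q} (suc b) bounded q ¬greatest = ¬¬-excluded-middle λ where
  (yes qb) → ¬greatest (suc b , qb , bounded)
  (no ¬qb) → ¬¬-greatest b (λ k qk → ≤-pred (≤∧≢⇒< (bounded k qk) λ { refl → ¬qb qk })) q ¬greatest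

¬¬-choice : ∀ {n} {A : Set} {Q : Fin n → A → Set} → (∀ e → ¬ ¬ Σ A (Q e)) →
            ¬ ¬ Σ (Vec A n) λ v → ∀ e → Q e (lookup v e)
¬¬-choice {zero}  _      ¬choice = ¬choice ([] , λ ())
¬¬-choice {suc n} ¬¬Q-at ¬choice = ¬¬Q-at zero λ (a , q₀) → ¬¬-choice (¬¬Q-at ∘ suc) λ (v , qs) →
  ¬choice (a ∷ v , λ { zero → q₀ ; (suc e) → qs e })

shatters-⊥ : ∀ {n} {L : List (SignVec n)} {T} → IsTope L T → Shatters L ⊥
shatters-⊥ T-tope _ _ = _ , T-tope , λ _ e∈⊥ → contradiction e∈⊥ ∉⊥

¬¬-VCdim : ∀ {n} (L : List (SignVec n)) {T} → IsTope L T → ¬ ¬ Σ ℕ (IsVCdim L)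
¬¬-VCdim {n} L T-tope ¬vc =
  ¬¬-greatest n (λ { _ (D , refl , _) → ∣p∣≤n D }) (0 , ⊥ , ∣⊥∣≡0 n , shatters-⊥ T-tope)
    λ { (d , witness , greatest) → ¬vc (d , witness , λ D D-sh → greatest _ (D , refl , D-sh)) }

module _ {n : ℕ} {L : List (SignVec n)} (om : IsOM L) where
  open IsOM om
  open DecMembership (_≟ᶠ_ {n}) using () renaming (_∈?_ to _∈ℓ?_)

  covector-nonzero-on : (es : List (Fin n)) →
                        Σ (SignVec n) λ Y → Y ∈ L × (∀ e → e ∈ es → lookup Y e ≢ zer)
  covector-nonzero-on []       = zeroᵛ , zero∈ , λ _ ()
  covector-nonzero-on (f ∷ es) with covector-nonzero-on es | noLoop f
  ... | Y , Y∈ , Y≢0 | X , X∈ , Xf≢0 = X ∘ᵛ Y , comp∈ X∈ Y∈ , XY≢0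
    where
    XY≢0 : ∀ e → e ∈ f ∷ es → lookup (X ∘ᵛ Y) e ≢ zer
    XY≢0 e (here refl) = subst (_≢ zer) (sym (lookup-∘ᵛ-≢zer X Y Xf≢0)) Xf≢0
    XY≢0 e (there e∈)  = subst (_≢ zer) (sym (lookup-∘ᵛ X Y e)) (compSign-≢zerʳ (lookup X e) (Y≢0 e e∈))

  F : SignVec n
  F = proj₁ (covector-nonzero-on (allFin n))

  F∈ : F ∈ L
  F∈ = proj₁ (proj₂ (covector-nonzero-on (allFin n)))

  F-full : FullSupport F
  F-full e = proj₂ (proj₂ (covector-nonzero-on (allFin n))) e (∈-allFin e)

  fullSupport⇒tope : ∀ {T} → T ∈ L → FullSupport T → IsTope L T
  fullSupport⇒tope {T} T∈ T-full = T∈ , λ Y _ T≤Y → ≡-lookup λ e → sym (≤ˢ⇒≡ (T≤Y e) (T-full e))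

  tope-full : ∀ {T} → IsTope L T → FullSupport T
  tope-full {T} (T∈ , T-max) e Te≡0 = compSign-≢zerʳ (lookup T e) (F-full e) TFe≡0
    where
    T≤TF : T ≤ᵛ (T ∘ᵛ F)
    T≤TF e = subst (lookup T e ≤ˢ_) (sym (lookup-∘ᵛ T F e)) (s≤ˢcompSign _ _)
    TFe≡0 : compSign (lookup T e) (lookup F e) ≡ zer
    TFe≡0 = trans (sym (lookup-∘ᵛ T F e))
                  (trans (cong (λ V → lookup V e) (T-max _ (comp∈ T∈ F∈) T≤TF)) Te≡0)

  ∘ᵛ-tope : ∀ {X T} → X ∈ L → IsTope L T → IsTope L (X ∘ᵛ T)
  ∘ᵛ-tope {X} {T} X∈ T-tope = fullSupport⇒tope (comp∈ X∈ (proj₁ T-tope)) λ e XTe≡0 →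
    compSign-≢zerʳ (lookup X e) (tope-full T-tope e) (trans (sym (lookup-∘ᵛ X T e)) XTe≡0)

  negᵛ-tope : ∀ {T} → IsTope L T → IsTope L (negᵛ T)
  negᵛ-tope {T} T-tope = fullSupport⇒tope (neg∈ (proj₁ T-tope)) λ e -Te≡0 →
    -neg-≢zer (tope-full T-tope e) (trans (sym (lookup-negᵛ T e)) -Te≡0)

  F-tope : IsTope L F
  F-tope = fullSupport⇒tope F∈ F-full

  zeroOut-tope : ∀ A {T} → IsTope L T → IsTope (delete L A) (zeroOut A T)
  zeroOut-tope A {T} T-tope = ∈-map⁺ (zeroOut A) (proj₁ T-tope) , maximal
    where
    maximal : ∀ Y → Y ∈ delete L A → zeroOut A T ≤ᵛ Y → Y ≡ zeroOut A T
    maximal Y Y∈ T≤Y with ∈-map⁻ (zeroOut A) Y∈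
    ... | X , _ , refl = ≡-lookup agree
      where
      agree : ∀ e → lookup (zeroOut A X) e ≡ lookup (zeroOut A T) e
      agree e with e ∈? A
      ... | yes e∈A = trans (lookup-zeroOut-∈ A X e∈A) (sym (lookup-zeroOut-∈ A T e∈A))
      ... | no  e∉A = sym (≤ˢ⇒≡ (T≤Y e) (subst (_≢ zer) (sym (lookup-zeroOut-∉ A T e∉A))
                                                 (tope-full T-tope e)))

  tope-of-delete : ∀ A {T′} → IsTope (delete L A) T′ →
                   Σ (SignVec n) λ T → IsTope L T × T′ ≡ zeroOut A T
  tope-of-delete A (T′∈ , T′-max) with ∈-map⁻ (zeroOut A) T′∈
  ... | X , X∈ , refl = X ∘ᵛ F , ∘ᵛ-tope X∈ F-tope ,
                        sym (T′-max _ (∈-map⁺ (zeroOut A) (comp∈ X∈ F∈)) X≤XF)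
    where
    X≤XF : zeroOut A X ≤ᵛ zeroOut A (X ∘ᵛ F)
    X≤XF e with e ∈? A
    ... | yes e∈A = subst (_≤ˢ lookup (zeroOut A (X ∘ᵛ F)) e) (sym (lookup-zeroOut-∈ A X e∈A)) 0≤
    ... | no  e∉A rewrite lookup-zeroOut-∉ A X e∉A | lookup-zeroOut-∉ A (X ∘ᵛ F) e∉A
                        | lookup-∘ᵛ X F e = s≤ˢcompSign _ _

  eliminate : ∀ {X Y e} → X ∈ L → Y ∈ L → Sep X Y e →
              Σ (SignVec n) λ Z → Z ∈ L × lookup Z e ≡ zer
                × (∀ g → lookup X g ≡ lookup Y g → lookup Z g ≡ lookup X g)
                × (∀ g → lookup Y g ≡ zer → lookup Z g ≡ lookup X g)
  eliminate {X} {Y} X∈ Y∈ sep with strongElim X∈ Y∈ _ sep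
  ... | Z , Z∈ , Ze≡0 , Z≡XY = Z , Z∈ , Ze≡0 ,
        (λ g Xg≡Yg → trans (Z≡XY g (≡⇒¬Sep X Y Xg≡Yg)) (lookup-∘ᵛ-≡ X Y Xg≡Yg)) ,
        (λ g Yg≡0 → trans (Z≡XY g (zer⇒¬Sep X Y Yg≡0))
                          (trans (lookup-∘ᵛ X Y g)
                                 (trans (cong (compSign (lookup X g)) Yg≡0) (compSign-zerʳ _))))

-- Independent and shattered sets

  orient : ∀ {X e} t → X ∈ L → lookup X e ≢ zer → t ≢ zer →
           Σ (SignVec n) λ V → V ∈ L × lookup V e ≡ t × (∀ f → lookup X f ≡ zer → lookup V f ≡ zer)
  orient {X} {e} t X∈ Xe≢0 t≢0 with lookup X e ≟ˢ t
  ... | yes Xe≡t = X , X∈ , Xe≡t , λ _ Xf≡0 → Xf≡0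
  ... | no  Xe≢t = negᵛ X , neg∈ X∈ , -Xe≡t , λ f Xf≡0 → trans (lookup-negᵛ X f) (cong -neg Xf≡0)
    where
    -Xe≡t : lookup (negᵛ X) e ≡ t
    -Xe≡t = trans (lookup-negᵛ X e)
                  (trans (cong -neg (≢⇒≡-neg Xe≢0 t≢0 Xe≢t)) (-neg-involutive t))

  Isolates : Subset n → Fin n → SignVec n → Set
  Isolates D e X = X ∈ L × lookup X e ≢ zer × (∀ f → f ∈ˢ D → f ≢ e → lookup X f ≡ zer)

  Independent : Subset n → Set
  Independent D = ∀ e → e ∈ˢ D → ∃ (Isolates D e)

  independent⇒shatters : ∀ {D} → Independent D → Shatters L D
  independent⇒shatters {D} D-indep Z Z≢0 =
    Y ∘ᵛ F , ∘ᵛ-tope Y∈ F-tope , λ e e∈D →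
      trans (lookup-∘ᵛ-≢zer Y F (subst (_≢ zer) (sym (Y≡Z e e∈D (∈-allFin e))) (Z≢0 e e∈D)))
            (Y≡Z e e∈D (∈-allFin e))
    where
    matching : ∀ es → Σ (SignVec n) λ Y → Y ∈ L × (∀ g → g ∈ˢ D → g ∈ es → lookup Y g ≡ lookup Z g)
    matching []       = zeroᵛ , zero∈ , λ _ _ ()
    matching (f ∷ es) with matching es | f ∈? D
    ... | Y , Y∈ , Y≡Z | no f∉D = Y , Y∈ , λ where
      g g∈D (here refl) → contradiction g∈D f∉D
      g g∈D (there g∈)  → Y≡Z g g∈D g∈
    ... | Y , Y∈ , Y≡Z | yes f∈D with D-indep f f∈D
    ...   | X , X∈ , Xf≢0 , X≡0 with orient (lookup Z f) X∈ Xf≢0 (Z≢0 f f∈D)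
    ...     | V , V∈ , Vf≡Zf , V≡0 = V ∘ᵛ Y , comp∈ V∈ Y∈ , VY≡Z
      where
      VY≡Z : ∀ g → g ∈ˢ D → g ∈ f ∷ es → lookup (V ∘ᵛ Y) g ≡ lookup Z g
      VY≡Z g g∈D g∈ with g ≟ᶠ f
      ... | yes refl = trans (lookup-∘ᵛ-≢zer V Y (subst (_≢ zer) (sym Vf≡Zf) (Z≢0 f f∈D))) Vf≡Zf
      VY≡Z g g∈D (here g≡f) | no g≢f = contradiction g≡f g≢f
      VY≡Z g g∈D (there g∈) | no g≢f =
        trans (lookup-∘ᵛ-zer V Y (V≡0 g (X≡0 g g∈D g≢f))) (Y≡Z g g∈D g∈)
    Y   = proj₁ (matching (allFin n))
    Y∈  = proj₁ (proj₂ (matching (allFin n)))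
    Y≡Z = proj₂ (proj₂ (matching (allFin n)))

  flipAt : SignVec n → Fin n → SignVec n
  flipAt σ f = updateAt σ f -neg

  flipAt-full : ∀ σ f → FullSupport σ → FullSupport (flipAt σ f)
  flipAt-full σ f σ-full g with g ≟ᶠ f
  ... | yes refl = subst (_≢ zer) (sym (lookup∘updateAt f σ)) (-neg-≢zer (σ-full f))
  ... | no  g≢f  = subst (_≢ zer) (sym (lookup∘updateAt′ g f g≢f σ)) (σ-full g)

  -- Topes realise every sign pattern σ on a shattered set D; eliminating at f between realisers of σ
  -- and of σ flipped at f kills coordinate f and keeps the others, until all of D - e is killed.
  record Realises (D : Subset n) (e : Fin n) (zs : List (Fin n)) (σ : SignVec n) : Set where
    constructor realisedBy
    field
      X        : SignVec n
      X∈       : X ∈ L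
      at-e     : lookup X e ≡ lookup σ e
      vanishes : ∀ g → g ∈ˢ D → g ≢ e → g ∈ zs → lookup X g ≡ zer
      follows  : ∀ g → g ∈ˢ D → g ≢ e → ¬ g ∈ zs → lookup X g ≡ lookup σ g

  realises-∷ : ∀ {D e zs σ} f (R : Realises D e zs σ) →
               (∀ g → g ∈ˢ D → g ≢ e → g ≡ f → lookup (Realises.X R) g ≡ zer) →
               Realises D e (f ∷ zs) σ
  realises-∷ f (realisedBy X X∈ Xe X-vanishes X-follows) X≡0-at-f = realisedBy X X∈ Xe
    (λ { g g∈D g≢e (here g≡f) → X≡0-at-f g g∈D g≢e g≡f
       ; g g∈D g≢e (there g∈) → X-vanishes g g∈D g≢e g∈ })
    (λ g g∈D g≢e g∉ → X-follows g g∈D g≢e (g∉ ∘ there))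

  vanish-at : ∀ {D e zs σ f} → FullSupport σ → f ∈ˢ D → f ≢ e → ¬ f ∈ zs →
              Realises D e zs σ → Realises D e zs (flipAt σ f) → Realises D e (f ∷ zs) σ
  vanish-at {D} {e} {zs} {σ} {f} σ-full f∈D f≢e f∉zs
            (realisedBy X X∈ Xe X-vanishes X-follows) (realisedBy Y Y∈ Ye Y-vanishes Y-follows)
    with eliminate X∈ Y∈ sep
    where
    Xf : lookup X f ≡ lookup σ f
    Xf = X-follows f f∈D f≢e f∉zs
    Yf : lookup Y f ≡ -neg (lookup σ f)
    Yf = trans (Y-follows f f∈D f≢e f∉zs) (lookup∘updateAt f σ)
    sep : Sep X Y f
    sep = subst (_≢ zer) (sym Xf) (σ-full f) ,
          trans Xf (trans (sym (-neg-involutive _)) (cong -neg (sym Yf)))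
  ... | Z , Z∈ , Zf≡0 , Z-agrees , _ = realisedBy Z Z∈ (trans (Z-agrees e Xe≡Ye) Xe) Z-vanishes Z-follows
    where
    Xe≡Ye : lookup X e ≡ lookup Y e
    Xe≡Ye = trans Xe (sym (trans Ye (lookup∘updateAt′ e f (f≢e ∘ sym) σ)))
    Z-vanishes : ∀ g → g ∈ˢ D → g ≢ e → g ∈ f ∷ zs → lookup Z g ≡ zer
    Z-vanishes g g∈D g≢e (here refl) = Zf≡0
    Z-vanishes g g∈D g≢e (there g∈)  =
      trans (Z-agrees g (trans Xg≡0 (sym (Y-vanishes g g∈D g≢e g∈)))) Xg≡0
      where Xg≡0 = X-vanishes g g∈D g≢e g∈
    Z-follows : ∀ g → g ∈ˢ D → g ≢ e → ¬ g ∈ f ∷ zs → lookup Z g ≡ lookup σ g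
    Z-follows g g∈D g≢e g∉ = trans (Z-agrees g (trans Xg≡σg (sym Yg≡σg))) Xg≡σg
      where
      Xg≡σg = X-follows g g∈D g≢e (g∉ ∘ there)
      Yg≡σg = trans (Y-follows g g∈D g≢e (g∉ ∘ there)) (lookup∘updateAt′ g f (g∉ ∘ here) σ)

  realise : ∀ {D e} → Shatters L D → e ∈ˢ D → ∀ zs σ → FullSupport σ → Realises D e zs σ
  realise {D} {e} D-sh e∈D [] σ σ-full with D-sh σ (λ g _ → σ-full g)
  ... | T , T-tope , T≡σ =
    realisedBy T (proj₁ T-tope) (T≡σ e e∈D) (λ _ _ _ ()) (λ g g∈D _ _ → T≡σ g g∈D)
  realise {D} {e} D-sh e∈D (f ∷ zs) σ σ-full with f ∈? D | f ≟ᶠ e | f ∈ℓ? zs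
  ... | no f∉D  | _       | _      = realises-∷ f (realise D-sh e∈D zs σ σ-full)
                                       λ { g g∈D _ refl → contradiction g∈D f∉D }
  ... | yes _   | yes f≡e | _      = realises-∷ f (realise D-sh e∈D zs σ σ-full)
                                       λ { g _ g≢e refl → contradiction f≡e g≢e }
  ... | yes _   | no _    | yes f∈ = realises-∷ f R
                                       λ { g g∈D g≢e refl → Realises.vanishes R g g∈D g≢e f∈ }
    where R = realise D-sh e∈D zs σ σ-full
  ... | yes f∈D | no f≢e  | no f∉  = vanish-at σ-full f∈D f≢e f∉ (realise D-sh e∈D zs σ σ-full)
                                       (realise D-sh e∈D zs (flipAt σ f) (flipAt-full σ f σ-full))

  shatters⇒independent : ∀ {D} → Shatters L D → Independent D
  shatters⇒independent D-sh e e∈D with realise D-sh e∈D (allFin n) (replicate n pos) replicate-pos-full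
  ... | realisedBy X X∈ Xe X-vanishes _ =
    X , X∈ , subst (_≢ zer) (sym Xe) (replicate-pos-full e) , λ f f∈D f≢e → X-vanishes f f∈D f≢e (∈-allFin f)

-- Deletion and VC-dimension

  delete-shatters⇒disjoint : ∀ A {D} → Shatters (delete L A) D → ∀ {e} → e ∈ˢ D → e ∉ˢ A
  delete-shatters⇒disjoint A D-sh {e} e∈D e∈A
    with D-sh (replicate n pos) (λ g _ → replicate-pos-full g)
  ... | T′ , T′-tope , T′≡+ with tope-of-delete A T′-tope
  ...   | T , _ , refl = replicate-pos-full e (trans (sym (T′≡+ e e∈D)) (lookup-zeroOut-∈ A T e∈A))

  delete-shatters⇒shatters : ∀ A {D} → Shatters (delete L A) D → Shatters L D
  delete-shatters⇒shatters A D-sh Z Z≢0 with D-sh Z Z≢0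
  ... | T′ , T′-tope , T′≡Z with tope-of-delete A T′-tope
  ...   | T , T-tope , refl = T , T-tope , λ e e∈D →
          trans (sym (lookup-zeroOut-∉ A T (delete-shatters⇒disjoint A D-sh e∈D))) (T′≡Z e e∈D)

  shatters⇒delete-shatters : ∀ A {D} → (∀ {e} → e ∈ˢ D → e ∉ˢ A) →
                             Shatters L D → Shatters (delete L A) D
  shatters⇒delete-shatters A disjoint D-sh Z Z≢0 with D-sh Z Z≢0
  ... | T , T-tope , T≡Z = zeroOut A T , zeroOut-tope A T-tope , λ e e∈D →
          trans (lookup-zeroOut-∉ A T (disjoint e∈D)) (T≡Z e e∈D)

  NonzeroCovectorIn : Subset n → Set
  NonzeroCovectorIn A =
    Σ (SignVec n) λ X → X ∈ L × (∃ λ e → lookup X e ≢ zer) × (∀ f → f ∉ˢ A → lookup X f ≡ zer)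

  nonzeroCovectorIn⇒VC-drops : ∀ {A d₁ d₂} → NonzeroCovectorIn A →
                               IsVCdim L d₁ → IsVCdim (delete L A) d₂ → d₂ < d₁
  nonzeroCovectorIn⇒VC-drops {A} (X , X∈ , (e , Xe≢0) , X-outside) (_ , greatest₁) ((D , refl , D-sh) , _) =
    <-≤-trans (p⊂q⇒∣p∣<∣q∣ D⊂D′) (greatest₁ D′ D′-sh)
    where
    D′ = D ∪ ⁅ e ⁆
    e∈D′ : e ∈ˢ D′
    e∈D′ = x∈p∪q⁺ (inj₂ (x∈⁅x⁆ e))
    e∈A : e ∈ˢ A
    e∈A with e ∈? A
    ... | yes e∈A = e∈A
    ... | no  e∉A = contradiction (X-outside e e∉A) Xe≢0
    D⊂D′ : D ⊂ D′
    D⊂D′ = p⊆p∪q ⁅ e ⁆ , e , e∈D′ , λ e∈D → delete-shatters⇒disjoint A D-sh e∈D e∈A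
    D′-sh : Shatters L D′
    D′-sh Z Z≢0 with delete-shatters⇒shatters A D-sh Z (λ g g∈D → Z≢0 g (x∈p∪q⁺ (inj₁ g∈D)))
                   | orient (lookup Z e) X∈ Xe≢0 (Z≢0 e e∈D′)
    ... | T , T-tope , T≡Z | V , V∈ , Ve≡Ze , V-vanishes = V ∘ᵛ T , ∘ᵛ-tope V∈ T-tope , VT≡Z
      where
      VT≡Z : ∀ g → g ∈ˢ D′ → lookup (V ∘ᵛ T) g ≡ lookup Z g
      VT≡Z g g∈D′ with x∈p∪q⁻ D ⁅ e ⁆ g∈D′
      ... | inj₁ g∈D =
        trans (lookup-∘ᵛ-zer V T (V-vanishes g (X-outside g (delete-shatters⇒disjoint A D-sh g∈D))))
              (T≡Z g g∈D)
      ... | inj₂ g∈⁅e⁆ rewrite x∈⁅y⁆⇒x≡y e g∈⁅e⁆ =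
        trans (lookup-∘ᵛ-≢zer V T (subst (_≢ zer) (sym Ve≡Ze) (Z≢0 e e∈D′))) Ve≡Ze

  swap-independent : ∀ {D a f X} → Independent D → Isolates D a X → f ∉ˢ D → lookup X f ≢ zer →
                     Independent ((D - a) ∪ ⁅ f ⁆)
  swap-independent {D} {a} {f} {X} D-indep (X∈ , _ , X-vanishes) f∉D Xf≢0 e e∈D′ with ∈-swap⁻ e∈D′
  ... | inj₁ refl = X , X∈ , Xf≢0 , λ g g∈D′ g≢f →
    [ (λ g≡f → contradiction g≡f g≢f) , (λ (g∈D , g≢a) → X-vanishes g g∈D g≢a) ]′ (∈-swap⁻ g∈D′)
  ... | inj₂ (e∈D , e≢a) with D-indep e e∈D
  ...   | Y , Y∈ , Ye≢0 , Y-vanishes with lookup Y f ≟ˢ zer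
  ...     | yes Yf≡0 = Y , Y∈ , Ye≢0 , λ g g∈D′ g≢e →
    [ (λ { refl → Yf≡0 }) , (λ (g∈D , _) → Y-vanishes g g∈D g≢e) ]′ (∈-swap⁻ g∈D′)
  ...     | no  Yf≢0 with orient (-neg (lookup Y f)) X∈ Xf≢0 (-neg-≢zer Yf≢0)
  ...       | W , W∈ , Wf≡-Yf , W-vanishes
    with eliminate Y∈ W∈ (Yf≢0 , trans (sym (-neg-involutive _)) (cong -neg (sym Wf≡-Yf)))
  ...         | Z , Z∈ , Zf≡0 , _ , Z-keeps =
    Z , Z∈ , subst (_≢ zer) (sym (Z-keeps e (W≡0 e∈D e≢a))) Ye≢0 , Z-vanishes
    where
    W≡0 : ∀ {g} → g ∈ˢ D → g ≢ a → lookup W g ≡ zer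
    W≡0 g∈D g≢a = W-vanishes _ (X-vanishes _ g∈D g≢a)
    Z-vanishes : ∀ g → g ∈ˢ (D - a) ∪ ⁅ f ⁆ → g ≢ e → lookup Z g ≡ zer
    Z-vanishes g g∈D′ g≢e with ∈-swap⁻ g∈D′
    ... | inj₁ refl         = Zf≡0
    ... | inj₂ (g∈D , g≢a) = trans (Z-keeps g (W≡0 g∈D g≢a)) (Y-vanishes g g∈D g≢e)

  support-leaves : ∀ {A X e} → ¬ NonzeroCovectorIn A → X ∈ L → lookup X e ≢ zer →
                   ∃ λ f → f ∉ˢ A × lookup X f ≢ zer
  support-leaves {A} {X} {e} ¬nz X∈ Xe≢0
    with ¬∀⟶∃¬ n (λ f → f ∈ˢ A ⊎ lookup X f ≡ zer) (λ f → (f ∈? A) ⊎-dec (lookup X f ≟ˢ zer)) X-outside⇒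
    where
    X-outside⇒ : ¬ (∀ f → f ∈ˢ A ⊎ lookup X f ≡ zer)
    X-outside⇒ X-in-A = ¬nz (X , X∈ , (e , Xe≢0) , λ f f∉A → [ flip contradiction f∉A , id ]′ (X-in-A f))
  ... | f , ¬f∈A⊎Xf≡0 = f , ¬f∈A⊎Xf≡0 ∘ inj₁ , ¬f∈A⊎Xf≡0 ∘ inj₂

  exchange : ∀ {A D a} → ¬ NonzeroCovectorIn A → Independent D → a ∈ˢ D → a ∈ˢ A →
             Σ (Subset n) λ D′ → Independent D′ × ∣ D ∣ ≤ ∣ D′ ∣ × D′ ∩ A ⊂ D ∩ A
  exchange {A} {D} {a} ¬nz D-indep a∈D a∈A with D-indep a a∈D
  ... | X , X∈ , Xa≢0 , X-vanishes with support-leaves ¬nz X∈ Xa≢0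
  ...   | f , f∉A , Xf≢0 =
    D′ , swap-independent D-indep (X∈ , Xa≢0 , X-vanishes) f∉D Xf≢0 , ∣D∣≤∣D′∣ , D′∩A⊂D∩A
    where
    f≢a : f ≢ a
    f≢a refl = f∉A a∈A
    f∉D : f ∉ˢ D
    f∉D f∈D = Xf≢0 (X-vanishes f f∈D f≢a)
    D′ = (D - a) ∪ ⁅ f ⁆
    ∣D∣≤∣D′∣ : ∣ D ∣ ≤ ∣ D′ ∣
    ∣D∣≤∣D′∣ = subst (_≤ ∣ D′ ∣) (sym (∣p∣≡1+∣p-x∣ a∈D))
                 (p⊂q⇒∣p∣<∣q∣ (p⊆p∪q ⁅ f ⁆ , f , x∈p∪q⁺ (inj₂ (x∈⁅x⁆ f)) , f∉D ∘ p─q⊆p D ⁅ a ⁆))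
    D′∩A⊂D∩A : D′ ∩ A ⊂ D ∩ A
    D′∩A⊂D∩A = D′∩A⊆D∩A , a , x∈p∩q⁺ (a∈D , a∈A) ,
               λ a∈ → [ f≢a ∘ sym , (λ (_ , a≢a) → a≢a refl) ]′ (∈-swap⁻ (proj₁ (x∈p∩q⁻ D′ A a∈)))
      where
      D′∩A⊆D∩A : D′ ∩ A ⊆ D ∩ A
      D′∩A⊆D∩A e∈ with x∈p∩q⁻ D′ A e∈
      ... | e∈D′ , e∈A with ∈-swap⁻ e∈D′
      ...   | inj₁ refl       = contradiction e∈A f∉A
      ...   | inj₂ (e∈D , _) = x∈p∩q⁺ (e∈D , e∈A)

  disjoint-independent : ∀ {A} → ¬ NonzeroCovectorIn A → ∀ k {D} → ∣ D ∩ A ∣ < k → Independent D →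
                         Σ (Subset n) λ D′ → Independent D′ × ∣ D ∣ ≤ ∣ D′ ∣ ×
                                             (∀ {e} → e ∈ˢ D′ → e ∉ˢ A)
  disjoint-independent {A} ¬nz (suc k) {D} ∣D∩A∣≤k D-indep with any? (λ a → a ∈? D ∩ A)
  ... | no  D∩A-empty = D , D-indep , ≤-refl , λ e∈D e∈A → D∩A-empty (_ , x∈p∩q⁺ (e∈D , e∈A))
  ... | yes (a , a∈D∩A) with x∈p∩q⁻ D A a∈D∩A
  ...   | a∈D , a∈A with exchange ¬nz D-indep a∈D a∈A
  ...     | D₁ , D₁-indep , ∣D∣≤∣D₁∣ , D₁∩A⊂D∩A
    with disjoint-independent ¬nz k (<-≤-trans (p⊂q⇒∣p∣<∣q∣ D₁∩A⊂D∩A) (≤-pred ∣D∩A∣≤k)) D₁-indep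
  ...       | D′ , D′-indep , ∣D₁∣≤∣D′∣ , disjoint = D′ , D′-indep , ≤-trans ∣D∣≤∣D₁∣ ∣D₁∣≤∣D′∣ , disjoint

  VCPreservedBy : Subset n → Set
  VCPreservedBy A = ∀ d₁ d₂ → IsVCdim L d₁ → IsVCdim (delete L A) d₂ → d₁ ≡ d₂

  VCPreservedBy⇔¬NonzeroCovectorIn : ∀ A → VCPreservedBy A ⇔ (¬ NonzeroCovectorIn A)
  VCPreservedBy⇔¬NonzeroCovectorIn A = mk⇔ preserved⇒ ⇒preserved
    where
    preserved⇒ : VCPreservedBy A → ¬ NonzeroCovectorIn A
    preserved⇒ preserved nz =
      ¬¬-VCdim L F-tope λ (d₁ , vc₁) → ¬¬-VCdim (delete L A) (zeroOut-tope A F-tope) λ (d₂ , vc₂) →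
        <-irrefl (sym (preserved d₁ d₂ vc₁ vc₂)) (nonzeroCovectorIn⇒VC-drops nz vc₁ vc₂)
    ⇒preserved : ¬ NonzeroCovectorIn A → VCPreservedBy A
    ⇒preserved ¬nz d₁ d₂ ((D₁ , refl , D₁-sh) , greatest₁) ((D₂ , refl , D₂-sh) , greatest₂)
      with disjoint-independent ¬nz (suc ∣ D₁ ∩ A ∣) ≤-refl (shatters⇒independent D₁-sh)
    ... | D′ , D′-indep , ∣D₁∣≤∣D′∣ , disjoint =
      ≤-antisym (≤-trans ∣D₁∣≤∣D′∣ (greatest₂ D′ D′-sh)) (greatest₁ D₂ (delete-shatters⇒shatters A D₂-sh))
      where
      D′-sh = shatters⇒delete-shatters A disjoint (independent⇒shatters D′-indep)

-- Geodesics in the tope graph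

  ∘ᵛ-tope-with-≢ : (φ : Sign → Sign) {X G : SignVec n} {e h : Fin n} {a b : Sign} →
                   X ∈ L → IsTope L G → lookup (X ∘ᵛ G) e ≡ a → lookup (X ∘ᵛ G) h ≡ b → a ≢ φ b →
                   Σ (SignVec n) λ Y → IsTope L Y × lookup Y e ≢ φ (lookup Y h)
  ∘ᵛ-tope-with-≢ φ X∈ G-tope refl refl a≢φb = _ , ∘ᵛ-tope X∈ G-tope , a≢φb

  -- Used with φ = id and φ = -neg, turning the covectors that witness simplicity into topes.
  tope-with-≢ : (φ : Sign → Sign) → φ zer ≡ zer → (∀ {s t} → φ s ≡ φ t → s ≡ t) →
                ∀ {X e h} → X ∈ L → lookup X e ≢ φ (lookup X h) →
                Σ (SignVec n) λ Y → IsTope L Y × lookup Y e ≢ φ (lookup Y h)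
  tope-with-≢ φ φ-zer φ-inj {X} {e} {h} X∈ Xe≢φXh with lookup X e ≟ˢ zer | lookup X h ≟ˢ zer
  ... | yes Xe≡0 | yes Xh≡0 = contradiction (trans Xe≡0 (trans (sym φ-zer) (cong φ (sym Xh≡0)))) Xe≢φXh
  ... | no  Xe≢0 | no  Xh≢0 =
    ∘ᵛ-tope-with-≢ φ X∈ F-tope (lookup-∘ᵛ-≢zer X F Xe≢0) (lookup-∘ᵛ-≢zer X F Xh≢0) Xe≢φXh
  ... | yes Xe≡0 | no  Xh≢0 with ≢⇒≢⊎≢ (φ (lookup X h)) (s≢-neg-s (F-full e))
  ...   | inj₁ φXh≢Fe  =
    ∘ᵛ-tope-with-≢ φ X∈ F-tope (lookup-∘ᵛ-zer X F Xe≡0) (lookup-∘ᵛ-≢zer X F Xh≢0) (φXh≢Fe ∘ sym)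
  ...   | inj₂ φXh≢-Fe =
    ∘ᵛ-tope-with-≢ φ X∈ (negᵛ-tope F-tope) (trans (lookup-∘ᵛ-zer X (negᵛ F) Xe≡0) (lookup-negᵛ F e))
                   (lookup-∘ᵛ-≢zer X (negᵛ F) Xh≢0) (φXh≢-Fe ∘ sym)
  tope-with-≢ φ φ-zer φ-inj {X} {e} {h} X∈ Xe≢φXh | no Xe≢0 | yes Xh≡0
    with ≢⇒≢⊎≢ {φ (lookup F h)} {φ (-neg (lookup F h))} (lookup X e) (s≢-neg-s (F-full h) ∘ φ-inj)
  ...   | inj₁ Xe≢φFh  =
    ∘ᵛ-tope-with-≢ φ X∈ F-tope (lookup-∘ᵛ-≢zer X F Xe≢0) (lookup-∘ᵛ-zer X F Xh≡0) Xe≢φFh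
  ...   | inj₂ Xe≢φ-Fh =
    ∘ᵛ-tope-with-≢ φ X∈ (negᵛ-tope F-tope) (lookup-∘ᵛ-≢zer X (negᵛ F) Xe≢0)
                   (trans (lookup-∘ᵛ-zer X (negᵛ F) Xh≡0) (lookup-negᵛ F h)) Xe≢φ-Fh

  tope-separating : ∀ {T} → IsTope L T → ∀ {e h} → e ≢ h →
                    Σ (SignVec n) λ Y → IsTope L Y ×
                      ((lookup Y e ≡ lookup T e × lookup Y h ≢ lookup T h) ⊎
                       (lookup Y h ≡ lookup T h × lookup Y e ≢ lookup T e))
  tope-separating {T} T-tope {e} {h} e≢h with lookup T e ≟ˢ lookup T h
  ... | yes Te≡Th with noPar e h e≢h
  ...   | X , X∈ , Xe≢Xh with tope-with-≢ id refl id X∈ Xe≢Xh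
  ...     | Y , Y-tope , Ye≢Yh with lookup Y e ≟ˢ lookup T e
  ...       | yes Ye≡Te =
    Y , Y-tope , inj₁ (Ye≡Te , λ Yh≡Th → Ye≢Yh (trans Ye≡Te (trans Te≡Th (sym Yh≡Th))))
  ...       | no  Ye≢Te = Y , Y-tope , inj₂ (trans Yh≡Te Te≡Th , Ye≢Te)
    where
    Yh≡Te : lookup Y h ≡ lookup T e
    Yh≡Te = both-≢⇒≡ (tope-full Y-tope e) (tope-full Y-tope h) (tope-full T-tope e)
                      (Ye≢Yh ∘ sym) (Ye≢Te ∘ sym)
  tope-separating {T} T-tope {e} {h} e≢h | no Te≢Th with noAntiPar e h e≢h
  ...   | X , X∈ , Xe≢-Xh with tope-with-≢ -neg refl -neg-injective X∈ Xe≢-Xh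
  ...     | Y , Y-tope , Ye≢-Yh
    with ≢-neg⇒≡ (tope-full Y-tope e) (tope-full Y-tope h) Ye≢-Yh | lookup Y e ≟ˢ lookup T e
  ...       | Ye≡Yh | yes Ye≡Te =
    Y , Y-tope , inj₁ (Ye≡Te , λ Yh≡Th → Te≢Th (trans (sym Ye≡Te) (trans Ye≡Yh Yh≡Th)))
  ...       | Ye≡Yh | no  Ye≢Te = Y , Y-tope , inj₂ (trans (sym Ye≡Yh) Ye≡Th , Ye≢Te)
    where
    Ye≡Th : lookup Y e ≡ lookup T h
    Ye≡Th = both-≢⇒≡ (tope-full T-tope e) (tope-full Y-tope e) (tope-full T-tope h)
                      Ye≢Te (Te≢Th ∘ sym)

  record StepToward (T W : SignVec n) : Set where
    constructor stepAt
    field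
      g          : Fin n
      T′         : SignVec n
      T′-tope    : IsTope L T′
      T≢W-at-g   : lookup T g ≢ lookup W g
      T′≡W-at-g  : lookup T′ g ≡ lookup W g
      T′≡T-off-g : ∀ h → h ≢ g → lookup T′ h ≡ lookup T h

  step-toward-⊆ : ∀ {T V W} → IsTope L T → IsTope L V → IsTope L W →
                  disagree T V ⊆ disagree T W → StepToward T V → StepToward T W
  step-toward-⊆ {T} {V} {W} T-tope V-tope W-tope TV⊆TW (stepAt g T′ T′-tope Tg≢Vg T′g≡Vg T′≡T) =
    stepAt g T′ T′-tope Tg≢Wg (trans T′g≡Vg Vg≡Wg) T′≡T
    where
    Tg≢Wg : lookup T g ≢ lookup W g
    Tg≢Wg = ∈-disagree⁻ {X = T} {W} (TV⊆TW (∈-disagree⁺ {X = T} {V} Tg≢Vg))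
    Vg≡Wg : lookup V g ≡ lookup W g
    Vg≡Wg = both-≢⇒≡ (tope-full T-tope g) (tope-full V-tope g) (tope-full W-tope g)
                      (Tg≢Vg ∘ sym) (Tg≢Wg ∘ sym)

  TopeStrictlyBetween : SignVec n → SignVec n → Set
  TopeStrictlyBetween T W =
    Σ (SignVec n) λ V → IsTope L V × disagree T V ⊂ disagree T W × ∃ λ q → lookup T q ≢ lookup V q

  -- Z agrees with T wherever T and W do, so each Z ∘ G lies between T and W; one of G = T, G = - T,
  -- or G a tope separating e from h puts it strictly between.
  strictly-between : ∀ {T W} → IsTope L T → IsTope L W → ∀ {e h} → e ≢ h →
                     lookup T e ≢ lookup W e → lookup T h ≢ lookup W h → TopeStrictlyBetween T W
  strictly-between {T} {W} T-tope W-tope {e} {h} e≢h Te≢We Th≢Wh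
    with eliminate (proj₁ T-tope) (proj₁ W-tope)
                   (tope-full T-tope e , ≢⇒≡-neg (tope-full T-tope e) (tope-full W-tope e) Te≢We)
  ... | Z , Z∈ , Ze≡0 , Z-agrees , _ = via-Z
    where
    Zf≢0 : ∀ {f} → lookup T f ≡ lookup W f → lookup Z f ≢ zer
    Zf≢0 {f} Tf≡Wf = subst (_≢ zer) (sym (Z-agrees f Tf≡Wf)) (tope-full T-tope f)
    Z∘-between : ∀ G → Between T W (Z ∘ᵛ G)
    Z∘-between G = between λ f Tf≡Wf → trans (lookup-∘ᵛ-≢zer Z G (Zf≢0 Tf≡Wf)) (Z-agrees f Tf≡Wf)
    via-Z : TopeStrictlyBetween T W
    via-Z with any? (λ q → ¬? (lookup T q ≟ˢ lookup (Z ∘ᵛ T) q))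
    ... | yes q≠ =
      Z ∘ᵛ T , ∘ᵛ-tope Z∈ T-tope , between⇒⊂ (Z∘-between T) Te≢We (lookup-∘ᵛ-zer Z T Ze≡0) , q≠
    ... | no  ZT≡T with any? (λ f → ¬? (lookup T f ≟ˢ lookup W f) ×-dec ¬? (lookup Z f ≟ˢ zer))
    ...   | yes (f , Tf≢Wf , Zf≢0′) =
      Z ∘ᵛ negᵛ T , ∘ᵛ-tope Z∈ (negᵛ-tope T-tope) , between⇒⊂ (Z∘-between (negᵛ T)) Tf≢Wf ZT⁻f≡Tf ,
      e , λ Te≡ → s≢-neg-s (tope-full T-tope e)
                    (trans Te≡ (trans (lookup-∘ᵛ-zer Z (negᵛ T) Ze≡0) (lookup-negᵛ T e)))
      where
      ZT⁻f≡Tf : lookup (Z ∘ᵛ negᵛ T) f ≡ lookup T f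
      ZT⁻f≡Tf = trans (lookup-∘ᵛ-≢zer Z (negᵛ T) Zf≢0′)
                      (trans (sym (lookup-∘ᵛ-≢zer Z T Zf≢0′))
                             (decidable-stable (_ ≟ˢ _) λ ne → ZT≡T (f , ne ∘ sym)))
    ...   | no Z-vanishes = [ uncurry (finish Te≢We Th≢Wh) , uncurry (finish Th≢Wh Te≢We) ]′ Y-separates
      where
      Y = proj₁ (tope-separating T-tope e≢h)
      Y-tope = proj₁ (proj₂ (tope-separating T-tope e≢h))
      Y-separates = proj₂ (proj₂ (tope-separating T-tope e≢h))
      ZY≡Y : ∀ {f} → lookup T f ≢ lookup W f → lookup (Z ∘ᵛ Y) f ≡ lookup Y f
      ZY≡Y Tf≢Wf = lookup-∘ᵛ-zer Z Y (decidable-stable (_ ≟ˢ _) λ Zf≢0′ → Z-vanishes (_ , Tf≢Wf , Zf≢0′))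
      finish : ∀ {p q} → lookup T p ≢ lookup W p → lookup T q ≢ lookup W q →
               lookup Y p ≡ lookup T p → lookup Y q ≢ lookup T q → TopeStrictlyBetween T W
      finish Tp≢Wp Tq≢Wq Yp≡Tp Yq≢Tq =
        Z ∘ᵛ Y , ∘ᵛ-tope Z∈ Y-tope , between⇒⊂ (Z∘-between Y) Tp≢Wp (trans (ZY≡Y Tp≢Wp) Yp≡Tp) ,
        _ , λ Tq≡ → Yq≢Tq (sym (trans Tq≡ (ZY≡Y Tq≢Wq)))

  step-toward : ∀ k {T W} → ∣ disagree T W ∣ < k → IsTope L T → IsTope L W →
                ∀ {e} → lookup T e ≢ lookup W e → StepToward T W
  step-toward (suc k) {T} {W} ∣TW∣≤k T-tope W-tope {e} Te≢We
    with any? (λ h → ¬? (h ≟ᶠ e) ×-dec ¬? (lookup T h ≟ˢ lookup W h))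
  ... | no only-e = stepAt e W W-tope Te≢We refl λ h h≢e →
        sym (decidable-stable (_ ≟ˢ _) λ Th≢Wh → only-e (h , h≢e , Th≢Wh))
  ... | yes (h , h≢e , Th≢Wh) with strictly-between T-tope W-tope (h≢e ∘ sym) Te≢We Th≢Wh
  ...   | V , V-tope , TV⊂TW , q , Tq≢Vq =
    step-toward-⊆ T-tope V-tope W-tope (proj₁ TV⊂TW)
      (step-toward k (<-≤-trans (p⊂q⇒∣p∣<∣q∣ TV⊂TW) (≤-pred ∣TW∣≤k)) T-tope V-tope Tq≢Vq)

-- The interval [S] and its oscillating coordinates

  module _ {S : SignVec n} where

    private
      H : SignVec n → Set
      H = Interval L S

    ≤ᵛ-change-at-zer : ∀ {T T′ g} → S ≤ᵛ T → (∀ f → f ≢ g → lookup T′ f ≡ lookup T f) →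
                       lookup S g ≡ zer → S ≤ᵛ T′
    ≤ᵛ-change-at-zer {T} {T′} {g} S≤T T′≡T Sg≡0 f with f ≟ᶠ g
    ... | yes refl = subst (_≤ˢ lookup T′ f) (sym Sg≡0) 0≤
    ... | no  f≢g  = subst (lookup S f ≤ˢ_) (sym (T′≡T f f≢g)) (S≤T f)

    leaving-edge⇒osc : ∀ {T T′ g} → H T → IsTope L T′ → lookup T g ≢ lookup T′ g →
                       (∀ f → f ≢ g → lookup T′ f ≡ lookup T f) → ¬ H T′ → Osc L H g
    leaving-edge⇒osc {T} {T′} {g} (T-tope , S≤T) T′-tope Tg≢T′g T′≡T T′∉H =
      no-inner-edge , T , T′ , (T-tope , T′-tope , Tg≢T′g , sym ∘₂ T′≡T) , (T-tope , S≤T) , T′∉H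
      where
      Sg≢0 : lookup S g ≢ zer
      Sg≢0 Sg≡0 = T′∉H (T′-tope , ≤ᵛ-change-at-zer {T} {T′} S≤T T′≡T Sg≡0)
      no-inner-edge : ¬ (Σ (SignVec n) λ T₁ → Σ (SignVec n) λ T₂ → H T₁ × H T₂ × EdgeE L g T₁ T₂)
      no-inner-edge (_ , _ , (_ , S≤T₁) , (_ , S≤T₂) , (_ , _ , T₁g≢T₂g , _)) =
        T₁g≢T₂g (trans (sym (≤ˢ⇒≡ (S≤T₁ g) Sg≢0)) (≤ˢ⇒≡ (S≤T₂ g) Sg≢0))

    osc⇒sign : ∀ {e} → Osc L H e → lookup S e ≢ zer × InHalf L H e (lookup S e)
    osc⇒sign {e} (_ , T , T′ , (_ , T′-tope , _ , T≡T′) , (_ , S≤T) , T′∉H) =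
      Se≢0 , λ T″ (_ , S≤T″) → sym (≤ˢ⇒≡ (S≤T″ e) Se≢0)
      where
      Se≢0 : lookup S e ≢ zer
      Se≢0 Se≡0 = T′∉H (T′-tope , ≤ᵛ-change-at-zer {T} {T′} S≤T (sym ∘₂ T≡T′) Se≡0)

    interval-convex : ∀ k {T W} → ∣ disagree W T ∣ < k → H T → IsTope L W →
                      (∀ e → Osc L H e → lookup W e ≡ lookup T e) → S ≤ᵛ W
    interval-convex (suc k) {T} {W} ∣WT∣≤k (T-tope , S≤T) W-tope W≡T-on-osc
      with any? (λ e → ¬? (lookup T e ≟ˢ lookup W e))
    ... | no T≡W = λ e → subst (lookup S e ≤ˢ_) (decidable-stable (_ ≟ˢ _) λ ne → T≡W (e , ne)) (S≤T e)
    ... | yes (e , Te≢We) with step-toward (suc ∣ disagree T W ∣) ≤-refl T-tope W-tope Te≢We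
    ...   | stepAt g T′ T′-tope Tg≢Wg T′g≡Wg T′≡T with all? (λ f → lookup S f ≤ˢ? lookup T′ f)
    ...     | no  S≰T′ = contradiction (W≡T-on-osc g g-osc) (Tg≢Wg ∘ sym)
      where
      g-osc : Osc L H g
      g-osc = leaving-edge⇒osc (T-tope , S≤T) T′-tope (λ Tg≡T′g → Tg≢Wg (trans Tg≡T′g T′g≡Wg)) T′≡T
                               (λ (_ , S≤T′) → S≰T′ S≤T′)
    ...     | yes S≤T′ =
      interval-convex k (<-≤-trans (p⊂q⇒∣p∣<∣q∣ WT′⊂WT) (≤-pred ∣WT∣≤k)) (T′-tope , S≤T′) W-tope W≡T′-on-osc
      where
      ≢g : ∀ {f} → lookup W f ≡ lookup T f → f ≢ g
      ≢g Wf≡Tf refl = Tg≢Wg (sym Wf≡Tf)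
      WT′⊂WT : disagree W T′ ⊂ disagree W T
      WT′⊂WT = between⇒⊂ {T = W} {T} {T′} (between λ f Wf≡Tf → trans (T′≡T f (≢g Wf≡Tf)) (sym Wf≡Tf))
                         (Tg≢Wg ∘ sym) T′g≡Wg
      W≡T′-on-osc : ∀ e → Osc L H e → lookup W e ≡ lookup T′ e
      W≡T′-on-osc e e-osc = trans (W≡T-on-osc e e-osc) (sym (T′≡T e (≢g (W≡T-on-osc e e-osc))))

    osc-vanishing⇒support-vanishing : IsSample L S → ∀ {X} → X ∈ L → (∀ e → Osc L H e → lookup X e ≡ zer) →
                                      ∀ f → lookup S f ≢ zer → lookup X f ≡ zer
    osc-vanishing⇒support-vanishing (T , T-tope , S≤T) {X} X∈ X≡0-on-osc f Sf≢0 =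
      decidable-stable (_ ≟ˢ _) λ Xf≢0 →
        s≢-neg-s Xf≢0 (trans (sym (Sf≡Vf X∈ X≡0-on-osc Xf≢0))
                             (trans (Sf≡Vf (neg∈ X∈) -X≡0-on-osc (-Xf≢0 Xf≢0)) (lookup-negᵛ X f)))
      where
      -- V ∘ T agrees with T on osc [S], so it lies in [S]
      Sf≡Vf : ∀ {V} → V ∈ L → (∀ e → Osc L H e → lookup V e ≡ zer) → lookup V f ≢ zer → lookup S f ≡ lookup V f
      Sf≡Vf {V} V∈ V≡0-on-osc Vf≢0 = trans (≤ˢ⇒≡ (S≤VT f) Sf≢0) (lookup-∘ᵛ-≢zer V T Vf≢0)
        where
        S≤VT : S ≤ᵛ (V ∘ᵛ T)
        S≤VT = interval-convex (suc ∣ disagree (V ∘ᵛ T) T ∣) ≤-refl (T-tope , S≤T) (∘ᵛ-tope V∈ T-tope)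
                               λ e e-osc → lookup-∘ᵛ-zer V T (V≡0-on-osc e e-osc)
      -X≡0-on-osc : ∀ e → Osc L H e → lookup (negᵛ X) e ≡ zer
      -X≡0-on-osc e e-osc = trans (lookup-negᵛ X e) (cong -neg (X≡0-on-osc e e-osc))
      -Xf≢0 : lookup X f ≢ zer → lookup (negᵛ X) f ≢ zer
      -Xf≢0 Xf≢0 = subst (_≢ zer) (sym (lookup-negᵛ X f)) (-neg-≢zer Xf≢0)

    module _ {S′ : SignVec n} (S′-Sbot : IsSbot L H S′) where

      osc⇒Sbot≢0 : ∀ {e} → Osc L H e → lookup S′ e ≢ zer
      osc⇒Sbot≢0 {e} e-osc with lookup S e | osc⇒sign e-osc
      ... | pos | _ , e-half = subst (_≢ zer) (sym (proj₂ (proj₁ (S′-Sbot e)) (e-osc , e-half))) λ ()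
      ... | neg | _ , e-half = subst (_≢ zer) (sym (proj₂ (proj₂ (S′-Sbot e)) (e-osc , e-half))) λ ()
      ... | zer | Se≢0 , _   = contradiction refl Se≢0

      Sbot≢0⇒osc : ∀ {e} → lookup S′ e ≢ zer → Osc L H e
      Sbot≢0⇒osc {e} S′e≢0 with lookup S′ e in S′e
      ... | pos = proj₁ (proj₁ (proj₁ (S′-Sbot e)) S′e)
      ... | neg = proj₁ (proj₁ (proj₂ (S′-Sbot e)) S′e)
      ... | zer = contradiction refl S′e≢0

      nonzeroCovectorIn-zeroSet-Sbot : IsSample L S →
                                       NonzeroCovectorIn (zeroSet S) ⇔ NonzeroCovectorIn (zeroSet S′)
      nonzeroCovectorIn-zeroSet-Sbot S-sample = mk⇔
        (λ (X , X∈ , X≢0 , X-outside) → X , X∈ , X≢0 , λ f f∉S′⁰ →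
          X-outside f λ f∈S⁰ → f∉S′⁰ (∈-zeroSet⁺ S′ (decidable-stable (_ ≟ˢ _) λ S′f≢0 →
            proj₁ (osc⇒sign (Sbot≢0⇒osc S′f≢0)) (∈-zeroSet⁻ S f∈S⁰))))
        (λ (X , X∈ , X≢0 , X-outside) → X , X∈ , X≢0 , λ f f∉S⁰ →
          osc-vanishing⇒support-vanishing S-sample X∈
            (λ e e-osc → X-outside e λ e∈S′⁰ → osc⇒Sbot≢0 e-osc (∈-zeroSet⁻ S′ e∈S′⁰))
            f (f∉S⁰ ∘ ∈-zeroSet⁺ S))

    ¬¬-Sbot : IsSample L S → ¬ ¬ Σ (SignVec n) (IsSbot L H)
    ¬¬-Sbot (T , T-tope , S≤T) = ¬¬-choice λ e ¬Q →
      ¬¬-excluded-middle λ pos? → ¬¬-excluded-middle λ neg? → ¬Q (choose e pos? neg?)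
      where
      P₊ P₋ : Fin n → Set
      P₊ e = Osc L H e × InHalf L H e pos
      P₋ e = Osc L H e × InHalf L H e neg
      ¬P₊×P₋ : ∀ {e} → P₊ e → ¬ P₋ e
      ¬P₊×P₋ (_ , half₊) (_ , half₋) with trans (sym (half₊ T (T-tope , S≤T))) (half₋ T (T-tope , S≤T))
      ... | ()
      choose : ∀ e → Dec (P₊ e) → Dec (P₋ e) →
               Σ Sign λ s → ((s ≡ pos → P₊ e) × (P₊ e → s ≡ pos)) × ((s ≡ neg → P₋ e) × (P₋ e → s ≡ neg))
      choose e (yes p₊) _        = pos , (const p₊ , const refl) , ((λ ()) , contradiction p₊ ∘ flip ¬P₊×P₋)
      choose e (no ¬p₊) (yes p₋) = neg , ((λ ()) , flip contradiction ¬p₊) , (const p₋ , const refl)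
      choose e (no ¬p₊) (no ¬p₋) = zer , ((λ ()) , flip contradiction ¬p₊) , ((λ ()) , flip contradiction ¬p₋)

lemma21 : (n : ℕ) (L : List (SignVec n)) → IsOM L →
          (S : SignVec n) → IsSample L S →
          FullSample L S ⇔ FullGraph L (Interval L S)
lemma21 n L om S S-sample = mk⇔ full⇒graph graph⇒full
  where
  open Equivalence
  full⇔ : ∀ S′ → FullSample L S′ ⇔ (¬ NonzeroCovectorIn om (zeroSet S′))
  full⇔ S′ = VCPreservedBy⇔¬NonzeroCovectorIn om (zeroSet S′)
  same-covectors : ∀ {S′} → IsSbot L (Interval L S) S′ →
                   NonzeroCovectorIn om (zeroSet S) ⇔ NonzeroCovectorIn om (zeroSet S′)
  same-covectors {S′} S′-Sbot = nonzeroCovectorIn-zeroSet-Sbot om {S} {S′} S′-Sbot S-sample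
  full⇒graph : FullSample L S → FullGraph L (Interval L S)
  full⇒graph S-full S′ S′-Sbot =
    from (full⇔ S′) (to (full⇔ S) S-full ∘ from (same-covectors S′-Sbot))
  graph⇒full : FullGraph L (Interval L S) → FullSample L S
  graph⇒full H-full = from (full⇔ S) λ nz → ¬¬-Sbot om {S} S-sample λ (S′ , S′-Sbot) →
    to (full⇔ S′) (H-full S′ S′-Sbot) (to (same-covectors S′-Sbot) nz)
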